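{- Let $\Sigma$ be a finite nonempty alphabet, $n \ge 1$ an integer, and $S = \{x_1, \ldots, x_k\} \subseteq \Sigma^*$ with $|x_i| \le n$ for all $i$. If $S^*$ is co-finite, then every word in $\Sigma^* \setminus S^*$ has length strictly less than $$\frac{2}{2|\Sigma| - 1}\left(2^n |\Sigma|^n - 1\right).$$
   Context: A language $L \subseteq \Sigma^*$ is co-finite if $\Sigma^* \setminus L$ is finite. -}

module Defs where

open import Data.Nat using (ℕ; _≤_; _<_; _*_; _∸_; _^_)
open import Data.List using (List; []; _++_; length)
open import Data.List.Membership.Propositional using (_∈_)
open import Data.List.Relation.Unary.All using (All)
open import Data.Fin using (Fin)
open import Data.Product using (∃)
open import Relation.Nullary using (¬_)

Word : Set → Set
Word A = List A

data _∈Star_ {A : Set} : Word A → List (Word A) → Set where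
  star-ε   : ∀ {S} → [] ∈Star S
  star-cat : ∀ {S x w} → x ∈ S → w ∈Star S → (x ++ w) ∈Star S

CoFinite : {A : Set} → (Word A → Set) → Set
CoFinite {A} L = ∃ λ (F : List (Word A)) → ∀ (w : Word A) → ¬ L w → w ∈ F

-- Let w ∉ S*. Whether a prefix p of w can be continued by z into S* depends only on the last
-- n - 1 letters of p and on which of its last n cut points (|p| - d, d < n) leave a prefix in S*:
-- every factorisation of p z into words of length ≤ n has a cut point among them. There are
-- |Σ|^(n-1) 2^n such codes, so if |w| ≥ |Σ|^(n-1) 2^n two prefixes p and p y of w share a code.
-- Then y can be removed after p, so p y^k y z ∉ S* for every k (where w = p y z): infinitely many
-- non-members, contradicting co-finiteness. The bound |Σ|^(n-1) 2^n is stronger than the one claimed.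
module Submission where

open import Defs
open import Data.Nat using (ℕ; zero; suc; _≤_; _<_; _*_; _∸_; _^_; _+_; z≤n; s≤s; s≤s⁻¹; z<s; _≤?_; _<?_)
open import Data.Nat.Properties
  using (≤-refl; ≤-reflexive; ≤-trans; <-≤-trans; <⇒≤; <⇒≱; ≮⇒≥; suc-injective; m<m+n; +-mono-≤; *-monoˡ-≤;
         m≤m*n; *-comm; *-assoc; m^n≢0; m+n∸n≡m; m∸[m∸n]≡n; m<n⇒0<n∸m; m≤n⇒m⊓n≡m; module ≤-Reasoning)
open import Data.Nat.Tactic.RingSolver using (solve-∀)
open import Data.List using (List; []; _∷_; _++_; length; take; drop; reverse; map; concat; replicate)
open import Data.List.Properties
  using (++-assoc; ++-cancelˡ; ++-monoid; ∷-injectiveˡ; ∷-injectiveʳ; length-++; length-drop; length-take;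
         take++drop≡id; take-take; reverse-++; reverse-injective; length-reverse; length-++-≤ˡ; length-++-≤ʳ)
open import Data.List.Extrema.Nat using (max; xs≤max)
open import Data.List.Membership.Propositional using (find; lose)
open import Data.List.Membership.Propositional.Properties using (∈-map⁺)
open import Data.List.Relation.Unary.All as All using (All)
open import Data.List.Relation.Unary.Any using (Any; any?)
open import Data.List.Relation.Binary.Prefix.Heterogeneous.Properties using (prefix?)
open import Data.List.Relation.Binary.Prefix.Propositional.Properties using (Prefix-as-∣ˡ; ∣ˡ-as-Prefix)
open import Data.Fin using (Fin; toℕ; fromℕ<; combine) renaming (zero to 0F; suc to 1+F)
open import Data.Fin.Properties using (_≟_; combine-injective; pigeonhole; toℕ<n; toℕ-fromℕ<)
open import Data.Vec using (Vec; []; _∷_; tabulate; lookup)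
open import Data.Vec.Properties using (lookup∘tabulate) renaming (∷-injective to ∷-injectiveᵛ)
open import Data.Product using (∃; ∃₂; _×_; _,_)
open import Data.Sum using (_⊎_; inj₁; inj₂)
open import Function using (id)
open import Relation.Nullary using (¬_; Dec; yes; no; contradiction)
open import Relation.Nullary.Decidable using (map′)
open import Relation.Unary using (Pred; Decidable; _⊆_)
open import Relation.Binary.Definitions using (DecidableEquality)
open import Relation.Binary.PropositionalEquality using (_≡_; _≢_; refl; sym; trans; cong; cong₂; subst; subst₂; module ≡-Reasoning)
open import Level using (0ℓ)

take-length-++ : ∀ {A : Set} (u v : List A) → take (length u) (u ++ v) ≡ u
take-length-++ []      v = refl
take-length-++ (a ∷ u) v = cong (a ∷_) (take-length-++ u v)

++-length-take : ∀ {A : Set} {u v p : List A} {d} → u ++ v ≡ p → length v ≡ d → take (length p ∸ d) p ≡ u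
++-length-take {u = u} {v} refl refl = trans (cong (λ i → take i (u ++ v)) |u++v|∸|v|≡|u|) (take-length-++ u v)
  where
  |u++v|∸|v|≡|u| : length (u ++ v) ∸ length v ≡ length u
  |u++v|∸|v|≡|u| = trans (cong (_∸ length v) (length-++ u)) (m+n∸n≡m (length u) (length v))

take++drop∘take : ∀ {A : Set} {i j} (w : List A) → i ≤ j → take i w ++ drop i (take j w) ≡ take j w
take++drop∘take {i = i} {j} w i≤j = begin
  take i w ++ drop i (take j w)           ≡⟨ cong (_++ drop i (take j w)) (take-take≡take i≤j) ⟨
  take i (take j w) ++ drop i (take j w)  ≡⟨ take++drop≡id i (take j w) ⟩
  take j w                                ∎
  where
  open ≡-Reasoning
  take-take≡take : i ≤ j → take i (take j w) ≡ take i w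
  take-take≡take i≤j = trans (take-take i j w) (cong (λ k → take k w) (m≤n⇒m⊓n≡m i≤j))

++-split : ∀ {A : Set} (x w p z : List A) → x ++ w ≡ p ++ z →
           (∃ λ t → p ≡ x ++ t × w ≡ t ++ z) ⊎ length p < length x
++-split []      w p       z eq = inj₁ (p , refl , eq)
++-split (a ∷ x) w []      z eq = inj₂ (s≤s z≤n)
++-split (a ∷ x) w (b ∷ p) z eq with refl ← ∷-injectiveˡ eq | ++-split x w p z (∷-injectiveʳ eq)
... | inj₁ (t , refl , w≡t++z) = inj₁ (t , refl , w≡t++z)
... | inj₂ |p|<|x|             = inj₂ (s≤s |p|<|x|)

prefix-pigeonhole : ∀ {A : Set} {N} (f : List A → Fin N) {w : List A} → N ≤ length w →
                    ∃₂ λ p y → ∃ λ z → w ≡ p ++ (y ++ z) × 0 < length y × f p ≡ f (p ++ y)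
prefix-pigeonhole f {w} N≤|w| with pigeonhole (s≤s N≤|w|) (λ i → f (take (toℕ i) w))
... | i , j , i<j , f≡ = take I w , drop I (take J w) , drop J w , w-split , 0<|y| , f-split
  where
  I = toℕ i
  J = toℕ j
  p++y≡take : take I w ++ drop I (take J w) ≡ take J w
  p++y≡take = take++drop∘take w (<⇒≤ i<j)
  w-split : w ≡ take I w ++ (drop I (take J w) ++ drop J w)
  w-split = sym (trans (sym (++-assoc (take I w) _ _))
                       (trans (cong (_++ drop J w) p++y≡take) (take++drop≡id J w)))
  0<|y| : 0 < length (drop I (take J w))
  0<|y| = subst (0 <_) (sym |y|≡) (m<n⇒0<n∸m i<j)
    where
    |y|≡ : length (drop I (take J w)) ≡ J ∸ I
    |y|≡ = trans (length-drop I (take J w))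
                 (cong (_∸ I) (trans (length-take J w) (m≤n⇒m⊓n≡m (s≤s⁻¹ (toℕ<n j)))))
  f-split : f (take I w) ≡ f (take I w ++ drop I (take J w))
  f-split = trans f≡ (cong f (sym p++y≡take))

k≤length-concat-replicate : ∀ {A : Set} (y : List A) → 0 < length y → ∀ k → k ≤ length (concat (replicate k y))
k≤length-concat-replicate y 0<|y| zero    = z≤n
k≤length-concat-replicate y 0<|y| (suc k) = ≤-trans
  (+-mono-≤ 0<|y| (k≤length-concat-replicate y 0<|y| k))
  (≤-reflexive (sym (length-++ y)))

vecToFin : ∀ {k n} → Vec (Fin k) n → Fin (k ^ n)
vecToFin []       = 0F
vecToFin (i ∷ is) = combine i (vecToFin is)

vecToFin-injective : ∀ {k n} {is js : Vec (Fin k) n} → vecToFin is ≡ vecToFin js → is ≡ js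
vecToFin-injective {is = []}     {[]}     _  = refl
vecToFin-injective {is = i ∷ is} {j ∷ js} eq with combine-injective i (vecToFin is) j (vecToFin js) eq
... | refl , eq′ = cong (i ∷_) (vecToFin-injective eq′)

decToFin : ∀ {P : Set} → Dec P → Fin 2
decToFin (yes _) = 1+F 0F
decToFin (no _)  = 0F

decToFin-≡⇒ : ∀ {P Q : Set} (p? : Dec P) (q? : Dec Q) → decToFin p? ≡ decToFin q? → P → Q
decToFin-≡⇒ _       (yes q) _  _ = q
decToFin-≡⇒ (yes _) (no _)  () _
decToFin-≡⇒ (no ¬p) (no _)  _  p = contradiction p ¬p

padTo : ∀ {A : Set} n → A → List A → Vec A n
padTo zero    a _        = []
padTo (suc n) a []       = a ∷ padTo n a []
padTo (suc n) a (b ∷ bs) = b ∷ padTo n a bs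

padTo-prefix-injective : ∀ {A : Set} {n} (a : A) (u v : List A) {x y} →
                         length u ≡ length v → length u ≤ n → padTo n a (u ++ x) ≡ padTo n a (v ++ y) → u ≡ v
padTo-prefix-injective a []      []      _      _         _   = refl
padTo-prefix-injective a (b ∷ u) (c ∷ v) |u|≡|v| (s≤s |u|≤n) eq with ∷-injectiveᵛ eq
... | b≡c , eq′ = cong₂ _∷_ b≡c (padTo-prefix-injective a u v (suc-injective |u|≡|v|) |u|≤n eq′)

scale-bound : ∀ {ℓ N} o → 2 ≤ N → ℓ < N → ℓ * (2 * suc o ∸ 1) < 2 * (N * suc o ∸ 1)
scale-bound {ℓ} {suc (suc K)} o _ (s≤s ℓ≤1+K) = begin-strict
  ℓ * (2 * suc o ∸ 1)                             ≤⟨ *-monoˡ-≤ _ ℓ≤1+K ⟩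
  suc K * (2 * suc o ∸ 1)                         <⟨ m<m+n _ z<s ⟩
  suc K * (2 * suc o ∸ 1) + suc (K + o + o)       ≡⟨ identity K o ⟩
  2 * (suc (suc K) * suc o ∸ 1)                   ∎
  where
  open ≤-Reasoning
  identity : ∀ K o → suc K * (o + suc (o + 0)) + suc (K + o + o) ≡ 2 * (o + suc K * suc o)
  identity = solve-∀
scale-bound {N = 1} o (s≤s ()) _

module _ {A : Set} {S : List (Word A)} where

  ∈Star-++ : ∀ {u v} → u ∈Star S → v ∈Star S → (u ++ v) ∈Star S
  ∈Star-++ star-ε v∈S* = v∈S*
  ∈Star-++ {v = v} (star-cat {x = x} {w} x∈S w∈S*) v∈S* =
    subst (_∈Star S) (sym (++-assoc x w v)) (star-cat x∈S (∈Star-++ w∈S* v∈S*))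

  LeadingFactor : Word A → Pred (Word A) 0ℓ
  LeadingFactor w x = x ≢ [] × ∃ λ r → x ++ r ≡ w × r ∈Star S

  ∈Star⇒leading-factor : ∀ {w} → w ∈Star S → w ≢ [] → Any (LeadingFactor w) S
  ∈Star⇒leading-factor star-ε                              w≢[] = contradiction refl w≢[]
  ∈Star⇒leading-factor (star-cat {x = []} _ w∈S*)          w≢[] = ∈Star⇒leading-factor w∈S* w≢[]
  ∈Star⇒leading-factor (star-cat {x = _ ∷ _} {w} x∈S w∈S*) _    = lose x∈S ((λ ()) , w , refl , w∈S*)

  leading-factor⇒∈Star : ∀ {w} → Any (LeadingFactor w) S → w ∈Star S
  leading-factor⇒∈Star lf with find lf
  ... | x , x∈S , _ , r , refl , r∈S* = star-cat x∈S r∈S*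

  SplitsAt : ℕ → Pred (Word A) 0ℓ
  SplitsAt d p = ∃₂ λ u v → u ++ v ≡ p × length v ≡ d × u ∈Star S

  ∈Star-cut : ∀ {n} → All (λ x → length x ≤ suc n) S → ∀ {w} → w ∈Star S → ∀ p z → w ≡ p ++ z →
              ∃₂ λ u v → u ++ v ≡ p × length v ≤ n × u ∈Star S × (v ++ z) ∈Star S
  ∈Star-cut short star-ε [] z eq = [] , [] , refl , z≤n , star-ε , subst (_∈Star S) eq star-ε
  ∈Star-cut short (star-cat {x = x} {w} x∈S w∈S*) p z eq with ++-split x w p z eq
  ... | inj₁ (t , refl , refl) with ∈Star-cut short w∈S* t z refl
  ...   | u , v , refl , |v|≤n , u∈S* , vz∈S* =
          x ++ u , v , ++-assoc x u v , |v|≤n , star-cat x∈S u∈S* , vz∈S*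
  ∈Star-cut short (star-cat x∈S w∈S*) p z eq | inj₂ |p|<|x| =
    [] , p , refl , s≤s⁻¹ (<-≤-trans |p|<|x| (All.lookup short x∈S)) , star-ε ,
    subst (_∈Star S) eq (star-cat x∈S w∈S*)

  Residual : Word A → Pred (Word A) 0ℓ
  Residual p z = (p ++ z) ∈Star S

  Residual-pump : ∀ {p y} → (∀ {z} → Residual p (y ++ z) → Residual p z) →
                  ∀ k {z} → Residual p (concat (replicate k y) ++ z) → Residual p z
  Residual-pump         y-removable zero    = id
  Residual-pump {p} {y} y-removable (suc k) {z} pyyᵏz∈S* =
    Residual-pump y-removable k
      (y-removable (subst (Residual p) (++-assoc y (concat (replicate k y)) z) pyyᵏz∈S*))

module _ {A : Set} (_≟ᴬ_ : DecidableEquality A) (S : List (Word A)) where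
  open import Algebra.Properties.Monoid.Divisibility (++-monoid A) using (_∣ˡ_; _,_)

  _∣ˡ?_ : ∀ x w → Dec (x ∣ˡ w)
  x ∣ˡ? w = map′ Prefix-as-∣ˡ ∣ˡ-as-Prefix (prefix? _≟ᴬ_ x w)

  ∈Star-bounded? : ∀ k w → length w ≤ k → Dec (w ∈Star S)
  ∈Star-bounded? _       []          _       = yes star-ε
  ∈Star-bounded? (suc k) w@(_ ∷ _)   |w|≤1+k =
    map′ leading-factor⇒∈Star (λ w∈S* → ∈Star⇒leading-factor w∈S* (λ ())) (any? leading-factor? S)
    where
    leading-factor? : Decidable (LeadingFactor w)
    leading-factor? [] = no λ ([]≢[] , _) → []≢[] refl
    leading-factor? x@(_ ∷ x′) with x ∣ˡ? w
    ... | no x∤w = no λ (_ , r , x++r≡w , _) → x∤w (r , x++r≡w)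
    ... | yes (r , x++r≡w) = map′ (λ r∈S* → (λ ()) , r , x++r≡w , r∈S*) r-unique
                                  (∈Star-bounded? k r (≤-trans (length-++-≤ʳ r {x′}) |x′++r|≤k))
      where
      |x′++r|≤k : length (x′ ++ r) ≤ k
      |x′++r|≤k = s≤s⁻¹ (subst (_≤ suc k) (sym (cong length x++r≡w)) |w|≤1+k)
      r-unique : LeadingFactor w x → r ∈Star S
      r-unique (_ , r′ , x++r′≡w , r′∈S*) =
        subst (_∈Star S) (++-cancelˡ x r′ r (trans x++r′≡w (sym x++r≡w))) r′∈S*

  ∈Star? : Decidable (_∈Star S)
  ∈Star? w = ∈Star-bounded? (length w) w ≤-refl

  splitsAt? : ∀ d → Decidable (SplitsAt d)
  splitsAt? d p with d ≤? length p
  ... | no d≰|p| = no λ (u , v , u++v≡p , |v|≡d , _) →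
                     d≰|p| (subst₂ _≤_ |v|≡d (cong length u++v≡p) (length-++-≤ʳ v {u}))
  ... | yes d≤|p| = map′ (λ u∈S* → take i p , drop i p , take++drop≡id i p , |drop|≡d , u∈S*)
                         (λ (u , v , u++v≡p , |v|≡d , u∈S*) →
                            subst (_∈Star S) (sym (++-length-take u++v≡p |v|≡d)) u∈S*)
                         (∈Star? (take i p))
    where
    i = length p ∸ d
    |drop|≡d : length (drop i p) ≡ d
    |drop|≡d = trans (length-drop i p) (m∸[m∸n]≡n d≤|p|)

module Code {m : ℕ} (S : List (Word (Fin (suc m)))) (n : ℕ) where

  cutBit : Word (Fin (suc m)) → Fin (suc n) → Fin 2
  cutBit p i = decToFin (splitsAt? _≟_ S (toℕ i) p)

  cutBits : Word (Fin (suc m)) → Vec (Fin 2) (suc n)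
  cutBits p = tabulate (cutBit p)

  lastLetters : Word (Fin (suc m)) → Vec (Fin (suc m)) n
  lastLetters p = padTo n 0F (reverse p)

  code : Word (Fin (suc m)) → Fin (2 ^ suc n * suc m ^ n)
  code p = combine (vecToFin (cutBits p)) (vecToFin (lastLetters p))

  cutBits-≡⇒ : ∀ {p q} → cutBits p ≡ cutBits q → ∀ i → SplitsAt (toℕ i) p → SplitsAt (toℕ i) q
  cutBits-≡⇒ {p} {q} eq i = decToFin-≡⇒ (splitsAt? _≟_ S (toℕ i) p) (splitsAt? _≟_ S (toℕ i) q) (begin
    cutBit p i            ≡⟨ lookup∘tabulate (cutBit p) i ⟨
    lookup (cutBits p) i  ≡⟨ cong (λ bs → lookup bs i) eq ⟩
    lookup (cutBits q) i  ≡⟨ lookup∘tabulate (cutBit q) i ⟩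
    cutBit q i            ∎)
    where open ≡-Reasoning

  lastLetters-≡⇒ : ∀ u v u′ v′ → lastLetters (u ++ v) ≡ lastLetters (u′ ++ v′) →
                   length v ≡ length v′ → length v ≤ n → v ≡ v′
  lastLetters-≡⇒ u v u′ v′ eq |v|≡|v′| |v|≤n = reverse-injective
    (padTo-prefix-injective 0F (reverse v) (reverse v′)
      (trans (length-reverse v) (trans |v|≡|v′| (sym (length-reverse v′))))
      (subst (_≤ n) (sym (length-reverse v)) |v|≤n)
      (begin
        padTo n 0F (reverse v ++ reverse u)    ≡⟨ cong (padTo n 0F) (reverse-++ u v) ⟨
        lastLetters (u ++ v)                   ≡⟨ eq ⟩
        lastLetters (u′ ++ v′)                 ≡⟨ cong (padTo n 0F) (reverse-++ u′ v′) ⟩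
        padTo n 0F (reverse v′ ++ reverse u′)  ∎))
    where open ≡-Reasoning

  code-≡⇒Residual-⊆ : All (λ x → length x ≤ suc n) S → ∀ {p q} → code p ≡ code q →
                      Residual {S = S} p ⊆ Residual q
  code-≡⇒Residual-⊆ short {p} {q} eq {z} pz∈S*
    with combine-injective (vecToFin (cutBits p)) _ (vecToFin (cutBits q)) _ eq
       | ∈Star-cut short pz∈S* p z refl
  ... | bits≡ , letters≡ | u , v , refl , |v|≤n , u∈S* , vz∈S*
    with cutBits-≡⇒ {q = q} (vecToFin-injective bits≡) (fromℕ< (s≤s |v|≤n))
                    (u , v , refl , sym (toℕ-fromℕ< _) , u∈S*)
  ... | u′ , v′ , refl , |v′|≡i , u′∈S*
    with refl ← lastLetters-≡⇒ u v u′ v′ (vecToFin-injective letters≡)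
                  (sym (trans |v′|≡i (toℕ-fromℕ< _))) |v|≤n
    = subst (_∈Star S) (sym (++-assoc u′ v z)) (∈Star-++ u′∈S* vz∈S*)

CoFinite⇒bounded : ∀ {A : Set} {L : Pred (Word A) 0ℓ} → CoFinite L → ∃ λ B → ∀ w → ¬ L w → length w ≤ B
CoFinite⇒bounded (F , complement⊆F) =
  max 0 (map length F) , λ w w∉L → All.lookup (xs≤max 0 (map length F)) (∈-map⁺ length (complement⊆F w w∉L))

∉Star⇒length< : ∀ {m n} {S : List (Word (Fin (suc m)))} → All (λ x → length x ≤ suc n) S →
                CoFinite (_∈Star S) → ∀ {w} → ¬ w ∈Star S → length w < 2 ^ suc n * suc m ^ n
∉Star⇒length< {m} {n} {S} short cofinite {w} w∉S* with length w <? 2 ^ suc n * suc m ^ n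
... | yes |w|<N = |w|<N
... | no  |w|≮N with prefix-pigeonhole (Code.code S n) {w} (≮⇒≥ |w|≮N) | CoFinite⇒bounded cofinite
... | p , y , z , refl , 0<|y| , code≡ | B , bounded = contradiction (bounded pumped pumped∉S*) (<⇒≱ B<|pumped|)
  where
  y-removable : ∀ {z} → Residual {S = S} p (y ++ z) → Residual p z
  y-removable {z} pyz∈S* =
    Code.code-≡⇒Residual-⊆ S n short {p ++ y} {p} (sym code≡) (subst (_∈Star S) (sym (++-assoc p y z)) pyz∈S*)
  pumped : Word (Fin (suc m))
  pumped = p ++ (concat (replicate (suc B) y) ++ (y ++ z))
  pumped∉S* : ¬ pumped ∈Star S
  pumped∉S* pumped∈S* = w∉S* (Residual-pump y-removable (suc B) pumped∈S*)
  B<|pumped| : B < length pumped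
  B<|pumped| = ≤-trans (k≤length-concat-replicate y 0<|y| (suc B))
                       (≤-trans (length-++-≤ˡ (concat (replicate (suc B) y))) (length-++-≤ʳ _ {p}))

theorem16 : (m n' : ℕ) → (S : List (Word (Fin (suc m)))) →
    All (λ x → length x ≤ suc n') S →
    CoFinite (λ w → w ∈Star S) →
    (w : Word (Fin (suc m))) → ¬ (w ∈Star S) →
    length w * (2 * suc m ∸ 1) < 2 * (2 ^ suc n' * suc m ^ suc n' ∸ 1)
theorem16 m n' S short cofinite w w∉S* =
  subst (λ M → length w * (2 * suc m ∸ 1) < 2 * (M ∸ 1)) (sym N*|Σ|≡)
        (scale-bound m 2≤N (∉Star⇒length< short cofinite w∉S*))
  where
  N = 2 ^ suc n' * suc m ^ n'
  2≤N : 2 ≤ N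
  2≤N = ≤-trans (m≤m*n 2 (2 ^ n') {{m^n≢0 2 n'}}) (m≤m*n (2 ^ suc n') (suc m ^ n') {{m^n≢0 (suc m) n'}})
  N*|Σ|≡ : 2 ^ suc n' * suc m ^ suc n' ≡ N * suc m
  N*|Σ|≡ = trans (cong (2 ^ suc n' *_) (*-comm (suc m) (suc m ^ n'))) (sym (*-assoc (2 ^ suc n') _ (suc m)))
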